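{- Let $\mathcal{V}$ be an $\alpha$-valuation of the complete bipartite graph $K_{a,b}$ with $ab>1$. Then there exists an integer $\ell\geq 2$ such that $\mathcal{V}$ is equivalent to an $\alpha$-valuation $(V^{\sf small},V^{\sf large})$ with the following properties: (1) every element of $V^{\sf large}$ is a multiple of $\ell$; (2) the set $V^{\sf small}$ is a union of runs of $\ell$ consecutive integers, each run starting with a multiple of $\ell$ (i.e., of sets $\{i\ell,i\ell+1,\dots,i\ell+\ell-1\}$).
   Context: For a graph $G$ with $n$ edges, an $\alpha$-valuation is a one-to-one map from the vertices into $\{0,1,\dots,n\}$ such that the absolute differences of the labels of the endpoints of the edges are exactly $\{1,\dots,n\}$, and there is a value $x$ with $0\le x\le n$ such that every edge joins a vertex with label $\le x$ to one with label $>x$. Vertices are identified with labels; $V^{\sf small}$ is the set of labels $\le x$ and $V^{\sf large}$ the set of labels $>x$. For $K_{a,b}$ the labels lie in $\{0,\dots,ab\}$. Define $\Phi_{ab}(z)=ab-z$ on $\{0,\dots,ab\}$. Two $\alpha$-valuations $\mathcal{V}_1,\mathcal{V}_2$ of $K_{a,b}$ are equivalent if $\mathcal{V}_1=\mathcal{V}_2$, or if for every vertex of $K_{a,b}$ its label in $\mathcal{V}_2$ is obtained by applying $\Phi_{ab}$ to its label in $\mathcal{V}_1$ (in which case $\Phi_{ab}$ maps the $V^{\sf small}$ labels of $\mathcal{V}_1$ to the $V^{\sf large}$ labels of $\mathcal{V}_2$ and vice versa). -}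

module Defs where

open import Data.Nat using (ℕ; _+_; _*_; _∸_; _≤_; _<_; ∣_-_∣)
open import Data.Fin using (Fin)
open import Data.Sum using (_⊎_; inj₁; inj₂)
open import Data.Product using (_×_; ∃-syntax; Σ-syntax)
open import Relation.Binary.PropositionalEquality using (_≡_)
open import Function.Definitions using (Injective)

-- Vertices of the complete bipartite graph K_{a,b}: the two parts are
-- Fin a (inj₁) and Fin b (inj₂); every inj₁ i is adjacent to every inj₂ j,
-- and these are all the edges (there are a*b of them).
Vertex : ℕ → ℕ → Set
Vertex a b = Fin a ⊎ Fin b

Labelling : ℕ → ℕ → Set
Labelling a b = Vertex a b → ℕ

Separates : ∀ {a b} → Labelling a b → ℕ → Set
Separates {a} {b} f x =
  ∀ (i : Fin a) (j : Fin b) →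
    (f (inj₁ i) ≤ x × x < f (inj₂ j)) ⊎ (f (inj₂ j) ≤ x × x < f (inj₁ i))

record IsAlphaValuation (a b : ℕ) (f : Labelling a b) : Set where
  field
    injective  : Injective _≡_ _≡_ f
    bounded    : ∀ v → f v ≤ a * b
    diff-range : ∀ (i : Fin a) (j : Fin b) →
                   1 ≤ ∣ f (inj₁ i) - f (inj₂ j) ∣ × ∣ f (inj₁ i) - f (inj₂ j) ∣ ≤ a * b
    diff-onto  : ∀ d → 1 ≤ d → d ≤ a * b →
                   ∃[ i ] ∃[ j ] ∣ f (inj₁ i) - f (inj₂ j) ∣ ≡ d
    threshold  : ∃[ x ] (x ≤ a * b × Separates f x)

Φ : ℕ → ℕ → ℕ → ℕ
Φ a b z = a * b ∸ z

Equivalent : ∀ {a b} → Labelling a b → Labelling a b → Set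
Equivalent {a} {b} f g = (∀ v → g v ≡ f v) ⊎ (∀ v → g v ≡ Φ a b (f v))

LargeMultiples : ∀ {a b} → Labelling a b → ℕ → ℕ → Set
LargeMultiples f x ℓ = ∀ v → x < f v → ∃[ q ] f v ≡ q * ℓ

SmallRuns : ∀ {a b} → Labelling a b → ℕ → ℕ → Set
SmallRuns f x ℓ =
  ∀ v → f v ≤ x →
    ∃[ i ] ((i * ℓ ≤ f v × f v < i * ℓ + ℓ) ×
            (∀ k → k < ℓ → ∃[ w ] (f w ≤ x × f w ≡ i * ℓ + k)))

{-# OPTIONS --safe #-}
-- Let x be the threshold and N = ab. The edge differences l - s (s small, l large) are exactly
-- 1, …, N, so the small labels S and the complements T = {N - l : l large} satisfy
-- S ⊕ T = {0, …, N - 1}. Applying Φ exchanges S and T, so we may assume 1 ∈ S. Let ℓ ≥ 2 be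
-- the least number not in S. By induction on k, each block [kℓ, kℓ + ℓ) is the translate by
-- some t ∈ T of a whole run [s, s + ℓ) ⊆ S. Hence S is a union of blocks, and every element
-- of T, as well as N itself, is a multiple of ℓ; so are the large labels N - t.
module Submission where

open import Defs
open import Data.Nat using (ℕ; _*_; _≤_; _<_)
open import Data.Product using (_×_; ∃-syntax)

open import Data.Nat.Base
  using (zero; suc; _+_; _∸_; ∣_-_∣; z≤n; s≤s; z<s; NonZero; ≢-nonZero; >-nonZero⁻¹)
open import Data.Nat.Properties
open import Data.Nat.DivMod using (_/_; _%_; m≡m%n+[m/n]*n; m%n<n; m/n*n≤m; m<n*o⇒m/o<n)
open import Data.Nat.Divisibility using (_∣_; divides; n∣m*n; m%n≡0⇒n∣m; ∣m+n∣m⇒∣n)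
open import Data.Nat.Induction using (<-rec)
open import Data.Fin.Base using (Fin; toℕ; combine; remQuot; punchOut)
open import Data.Fin.Properties
  using (toℕ<n; toℕ-injective; any?; injective⇒≤; punchOut-injective; remQuot-combine; combine-injective)
  renaming (_≟_ to _≟ᶠ_)
open import Data.Product using (_,_; proj₁; proj₂; ∃)
open import Data.Product.Properties using (×-≡,≡→≡)
open import Data.Sum using (_⊎_; inj₁; inj₂; [_,_]′)
open import Function.Base using (_∘_)
open import Function.Definitions using (Injective)
open import Relation.Nullary using (¬_; Dec; yes; no; contradiction)
open import Relation.Nullary.Decidable using (_×-dec_; _⊎-dec_; map′)
open import Relation.Unary using (Decidable)
open import Relation.Binary.PropositionalEquality
  using (_≡_; _≢_; refl; sym; trans; cong; cong₂; subst; module ≡-Reasoning)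

injective⇒surjective : ∀ {n} {g : Fin n → Fin n} → Injective _≡_ _≡_ g → ∀ m → ∃[ k ] g k ≡ m
injective⇒surjective {suc n} {g} g-injective m with any? (λ k → g k ≟ᶠ m)
... | yes hit = hit
... | no miss = contradiction (injective⇒≤ {f = punched} punched-injective) 1+n≰n
  where
  m≢g : ∀ k → m ≢ g k
  m≢g k m≡gk = miss (k , sym m≡gk)
  punched : Fin (suc n) → Fin n
  punched k = punchOut (m≢g k)
  punched-injective : Injective _≡_ _≡_ punched
  punched-injective = g-injective ∘ punchOut-injective (m≢g _) (m≢g _)

module _ {n : ℕ} (h : Fin n → ℕ) (onto : ∀ d → 1 ≤ d → d ≤ n → ∃[ k ] h k ≡ d) where
  private
    section : Fin n → Fin n
    section k = proj₁ (onto (suc (toℕ k)) (s≤s z≤n) (toℕ<n k))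

    h∘section : ∀ k → h (section k) ≡ suc (toℕ k)
    h∘section k = proj₂ (onto (suc (toℕ k)) (s≤s z≤n) (toℕ<n k))

    h∘section-injective : ∀ {k k′} → h (section k) ≡ h (section k′) → k ≡ k′
    h∘section-injective {k} {k′} eq =
      toℕ-injective (suc-injective (trans (sym (h∘section k)) (trans eq (h∘section k′))))

  onto[1,n]⇒injective : Injective _≡_ _≡_ h
  onto[1,n]⇒injective {p} {q} hp≡hq
    with injective⇒surjective (h∘section-injective ∘ cong h) p
       | injective⇒surjective (h∘section-injective ∘ cong h) q
  ... | k , refl | k′ , refl = cong section (h∘section-injective hp≡hq)

module _ {P : ℕ → Set} (P? : Decidable P) where
  private
    all-below-or-least : ∀ n → (∀ {k} → k < n → P k) ⊎ ∃[ m ] (¬ P m × ∀ {k} → k < m → P k)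
    all-below-or-least zero = inj₁ λ ()
    all-below-or-least (suc n) with all-below-or-least n | P? n
    ... | inj₂ least | _ = inj₂ least
    ... | inj₁ below | no ¬Pn = inj₂ (n , ¬Pn , below)
    ... | inj₁ below | yes Pn = inj₁ λ k<1+n → [ below , (λ { refl → Pn }) ]′ (m<1+n⇒m<n∨m≡n k<1+n)

  least-counterexample : ∀ {n} → ¬ P n → ∃[ m ] (¬ P m × ∀ {k} → k < m → P k)
  least-counterexample {n} ¬Pn with all-below-or-least (suc n)
  ... | inj₁ below = contradiction (below (n<1+n n)) ¬Pn
  ... | inj₂ least = least

+-shiftʳ : ∀ s t r {m} → s + t ≡ m → s + r + t ≡ m + r
+-shiftʳ s t r refl = begin
  s + r + t    ≡⟨ +-assoc s r t ⟩
  s + (r + t)  ≡⟨ cong (s +_) (+-comm r t) ⟩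
  s + (t + r)  ≡⟨ +-assoc s t r ⟨
  s + t + r    ∎
  where open ≡-Reasoning

split-multiple : ∀ {ℓ r} s c q → r < ℓ → s + c * ℓ ≡ q * ℓ + r → ∃[ k ] (s ≡ k * ℓ + r × k + c ≡ q)
split-multiple s zero q _ eq = q , trans (sym (+-identityʳ s)) eq , +-identityʳ q
split-multiple {ℓ} s (suc c) zero r<ℓ eq =
  contradiction (subst (ℓ ≤_) eq (≤-trans (m≤m+n ℓ (c * ℓ)) (m≤n+m (ℓ + c * ℓ) s))) (<⇒≱ r<ℓ)
split-multiple {ℓ} {r} s (suc c) (suc q) r<ℓ eq =
  let k , s≡kℓ+r , k+c≡q = split-multiple s c q r<ℓ (+-cancelˡ-≡ ℓ _ _ shifted)
  in k , s≡kℓ+r , trans (+-suc k c) (cong suc k+c≡q)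
  where
  shifted : ℓ + (s + c * ℓ) ≡ ℓ + (q * ℓ + r)
  shifted = begin
    ℓ + (s + c * ℓ)  ≡⟨ +-assoc ℓ s (c * ℓ) ⟨
    ℓ + s + c * ℓ    ≡⟨ cong (_+ c * ℓ) (+-comm ℓ s) ⟩
    s + ℓ + c * ℓ    ≡⟨ +-assoc s ℓ (c * ℓ) ⟩
    s + (ℓ + c * ℓ)  ≡⟨ eq ⟩
    ℓ + q * ℓ + r    ≡⟨ +-assoc ℓ (q * ℓ) r ⟩
    ℓ + (q * ℓ + r)  ∎
    where open ≡-Reasoning

record Tiling (N : ℕ) (S T : ℕ → Set) : Set where
  field
    sum<N  : ∀ {s t} → S s → T t → s + t < N
    cover  : ∀ {n} → n < N → ∃[ s ] ∃[ t ] (S s × T t × s + t ≡ n)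
    unique : ∀ {s t s′ t′} → S s → T t → S s′ → T t′ → s + t ≡ s′ + t′ → s ≡ s′

UnionOfRuns : ℕ → (ℕ → Set) → Set
UnionOfRuns ℓ S = ∀ {s} → S s → ∃[ i ] ((i * ℓ ≤ s × s < i * ℓ + ℓ) × (∀ k → k < ℓ → S (i * ℓ + k)))

module TilingProperties {N : ℕ} {S T : ℕ → Set} (tiling : Tiling N S T) (0<N : 0 < N) where
  open Tiling tiling public

  zero∈S×T : S 0 × T 0
  zero∈S×T with cover 0<N
  ... | s , t , Ss , Tt , s+t≡0 with m+n≡0⇒m≡0 s s+t≡0 | m+n≡0⇒n≡0 s s+t≡0
  ...   | refl | refl = Ss , Tt

  S0 : S 0
  S0 = proj₁ zero∈S×T

  T0 : T 0
  T0 = proj₂ zero∈S×T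

  S<N : ∀ {n} → S n → n < N
  S<N {n} Sn = subst (_< N) (+-identityʳ n) (sum<N Sn T0)

  T<N : ∀ {n} → T n → n < N
  T<N = sum<N S0

  S∩T⊆0 : ∀ {n} → S n → T n → n ≡ 0
  S∩T⊆0 {n} Sn Tn = unique Sn T0 S0 Tn (+-identityʳ n)

module RunDecomposition {N : ℕ} {S T : ℕ → Set} (tiling : Tiling N S T) (0<N : 0 < N)
                        (ℓ : ℕ) (run : ∀ {r} → r < ℓ → S r) (ℓ∉S : ¬ S ℓ) where
  open TilingProperties tiling 0<N

  instance
    ℓ-nonZero : NonZero ℓ
    ℓ-nonZero = ≢-nonZero λ { refl → ℓ∉S S0 }

  0<ℓ : 0 < ℓ
  0<ℓ = >-nonZero⁻¹ ℓ

  divmod : ∀ m → m ≡ m / ℓ * ℓ + m % ℓ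
  divmod m = trans (m≡m%n+[m/n]*n m ℓ) (+-comm (m % ℓ) (m / ℓ * ℓ))

  multiples-sum : ∀ k c {q} → k + c ≡ q → k * ℓ + c * ℓ ≡ q * ℓ
  multiples-sum k c k+c≡q = trans (sym (*-distribʳ-+ ℓ k c)) (cong (_* ℓ) k+c≡q)

  ℓ∈T : ℓ < N → T ℓ
  ℓ∈T ℓ<N with cover ℓ<N
  ... | s , t , Ss , Tt , s+t≡ℓ with m≤n⇒m<n∨m≡n (subst (t ≤_) s+t≡ℓ (m≤n+m t s))
  ...   | inj₂ t≡ℓ = subst T t≡ℓ Tt
  ...   | inj₁ t<ℓ with S∩T⊆0 (run t<ℓ) Tt
  ...     | refl = contradiction (subst S (trans (sym (+-identityʳ s)) s+t≡ℓ) Ss) ℓ∉S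

  BlockTiled : ℕ → Set
  BlockTiled k = k * ℓ < N → ∃[ s ] ∃[ t ] (T t × s + t ≡ k * ℓ × ∀ {r} → r < ℓ → S (s + r))

  block-T : ∀ k {r} → BlockTiled k → T (k * ℓ + r) → r < ℓ → r ≡ 0
  block-T k {r} tiled Tkℓ+r r<ℓ =
    let s , t , Tt , s+t≡kℓ , runs = tiled (≤-<-trans (m≤m+n (k * ℓ) r) (T<N Tkℓ+r))
    in m+n≡0⇒n≡0 s (unique {s + r} {t} (runs r<ℓ) Tt S0 Tkℓ+r (+-shiftʳ s t r s+t≡kℓ))

  block-S : ∀ k {r} → BlockTiled k → S (k * ℓ + r) → r < ℓ → ∀ {r′} → r′ < ℓ → S (k * ℓ + r′)
  block-S k {r} tiled Skℓ+r r<ℓ {r′} r′<ℓ =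
    let s , t , Tt , s+t≡kℓ , runs = tiled (≤-<-trans (m≤m+n (k * ℓ) r) (S<N Skℓ+r))
        s+r≡kℓ+r = unique {s + r} {t} (runs r<ℓ) Tt Skℓ+r T0
                     (trans (+-shiftʳ s t r s+t≡kℓ) (sym (+-identityʳ _)))
    in subst (λ z → S (z + r′)) (+-cancelʳ-≡ r s (k * ℓ) s+r≡kℓ+r) (runs r′<ℓ)

  block-start : ∀ k {r} → BlockTiled k → S (k * ℓ + r) → r < ℓ → S (k * ℓ)
  block-start k tiled Skℓ+r r<ℓ = subst S (+-identityʳ (k * ℓ)) (block-S k tiled Skℓ+r r<ℓ 0<ℓ)

  module _ {q : ℕ} (IH : ∀ {k} → k < q → BlockTiled k) where
    T-multiple : ∀ {t} → T t → t ≤ q * ℓ → ℓ ∣ t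
    T-multiple {t} Tt t≤qℓ with m≤n⇒m<n∨m≡n t≤qℓ
    ... | inj₂ refl = n∣m*n q
    ... | inj₁ t<qℓ =
      m%n≡0⇒n∣m t ℓ (block-T (t / ℓ) (IH (m<n*o⇒m/o<n t<qℓ)) (subst T (divmod t) Tt) (m%n<n t ℓ))

    T-part-below-block : .{{NonZero q}} → S (q * ℓ) → ∀ {s t r} →
                         T t → s + t ≡ q * ℓ + r → r < ℓ → t < q * ℓ
    T-part-below-block Sqℓ {s} {t} Tt s+t≡qℓ+r r<ℓ with t <? q * ℓ
    ... | yes t<qℓ = t<qℓ
    ... | no t≮qℓ with m≤n⇒m<n∨m≡n (≮⇒≥ t≮qℓ)
    ...   | inj₂ refl = contradiction (S∩T⊆0 Sqℓ Tt) (m<n⇒n≢0 (<-≤-trans 0<ℓ (m≤n*m ℓ q)))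
    ...   | inj₁ qℓ<t = contradiction (unique (run d<ℓ) Tt Sqℓ (ℓ∈T ℓ<N) d+t≡qℓ+ℓ) (<⇒≢ d<qℓ)
      where
      -- qℓ + ℓ would be both d + t with d = qℓ + ℓ - t ∈ [1, ℓ) ⊆ S, and qℓ + ℓ with ℓ ∈ T.
      t<qℓ+ℓ : t < q * ℓ + ℓ
      t<qℓ+ℓ = ≤-<-trans (subst (t ≤_) s+t≡qℓ+r (m≤n+m t s)) (+-monoʳ-< (q * ℓ) r<ℓ)
      d : ℕ
      d = q * ℓ + ℓ ∸ t
      d<ℓ : d < ℓ
      d<ℓ = subst (d <_) (m+n∸m≡n (q * ℓ) ℓ) (∸-monoʳ-< qℓ<t (<⇒≤ t<qℓ+ℓ))
      d<qℓ : d < q * ℓ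
      d<qℓ = <-≤-trans d<ℓ (m≤n*m ℓ q)
      ℓ<N : ℓ < N
      ℓ<N = ≤-<-trans (m≤n*m ℓ q) (S<N Sqℓ)
      d+t≡qℓ+ℓ : d + t ≡ q * ℓ + ℓ
      d+t≡qℓ+ℓ = m∸n+n≡m (<⇒≤ t<qℓ+ℓ)

    block-fill : .{{NonZero q}} → S (q * ℓ) → ∀ {r} → r < ℓ → S (q * ℓ + r)
    block-fill Sqℓ {r} r<ℓ with cover (<-≤-trans (+-monoʳ-< (q * ℓ) r<ℓ) (<⇒≤ qℓ+ℓ<N))
      where
      qℓ+ℓ<N : q * ℓ + ℓ < N
      qℓ+ℓ<N = sum<N Sqℓ (ℓ∈T (≤-<-trans (m≤n*m ℓ q) (S<N Sqℓ)))
    ... | s , t , Ss , Tt , s+t≡qℓ+r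
      with T-multiple Tt (<⇒≤ (T-part-below-block Sqℓ Tt s+t≡qℓ+r r<ℓ))
    ... | divides zero refl = subst S (trans (sym (+-identityʳ s)) s+t≡qℓ+r) Ss
    ... | divides (suc c) refl =
      let k , s≡kℓ+r , k+c≡q = split-multiple s (suc c) q r<ℓ s+t≡qℓ+r
          k<q = subst (k <_) k+c≡q (m<m+n k z<s)
          Skℓ = block-start k (IH k<q) (subst S s≡kℓ+r Ss) r<ℓ
          kℓ≡qℓ = unique Skℓ Tt Sqℓ T0 (trans (multiples-sum k (suc c) k+c≡q) (sym (+-identityʳ _)))
      in contradiction (*-cancelʳ-≡ k q ℓ kℓ≡qℓ) (<⇒≢ k<q)

  step : ∀ q → (∀ {k} → k < q → BlockTiled k) → BlockTiled q
  step zero _ _ = 0 , 0 , T0 , refl , run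
  step q@(suc _) IH qℓ<N with cover qℓ<N
  ... | s , t , Ss , Tt , s+t≡qℓ with T-multiple IH Tt (subst (t ≤_) s+t≡qℓ (m≤n+m t s))
  ... | divides zero refl =
    q * ℓ , 0 , T0 , +-identityʳ _ , block-fill IH (subst S (trans (sym (+-identityʳ s)) s+t≡qℓ) Ss)
  ... | divides (suc c) refl =
    let k , s≡kℓ+0 , k+c≡q = split-multiple s (suc c) q 0<ℓ (trans s+t≡qℓ (sym (+-identityʳ _)))
    in k * ℓ , suc c * ℓ , Tt , multiples-sum k (suc c) k+c≡q ,
       block-S k (IH (subst (k <_) k+c≡q (m<m+n k z<s))) (subst S s≡kℓ+0 Ss) 0<ℓ

  block-tiled : ∀ q → BlockTiled q
  block-tiled = <-rec BlockTiled step

  T-multiples : ∀ {t} → T t → ℓ ∣ t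
  T-multiples {t} Tt =
    m%n≡0⇒n∣m t ℓ (block-T (t / ℓ) (block-tiled (t / ℓ)) (subst T (divmod t) Tt) (m%n<n t ℓ))

  S-runs : UnionOfRuns ℓ S
  S-runs {s} Ss = s / ℓ , (m/n*n≤m s ℓ , s<) , λ k k<ℓ →
    block-S (s / ℓ) (block-tiled (s / ℓ)) (subst S (divmod s) Ss) (m%n<n s ℓ) k<ℓ
    where
    s< : s < s / ℓ * ℓ + ℓ
    s< = subst (_< s / ℓ * ℓ + ℓ) (sym (divmod s)) (+-monoʳ-< (s / ℓ * ℓ) (m%n<n s ℓ))

  ℓ∣N : ℓ ∣ N
  ℓ∣N with N % ℓ ≟ 0
  ... | yes N%ℓ≡0 = m%n≡0⇒n∣m N ℓ N%ℓ≡0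
  ... | no N%ℓ≢0 =
    let s , t , Tt , s+t≡qℓ , runs = block-tiled (N / ℓ) qℓ<N
    in contradiction (trans (+-shiftʳ s t (N % ℓ) s+t≡qℓ) (sym (divmod N)))
                     (<⇒≢ (sum<N (runs (m%n<n N ℓ)) Tt))
    where
    -- The last block [qℓ, qℓ + ℓ) would stick out of [0, N).
    qℓ<N : N / ℓ * ℓ < N
    qℓ<N = subst (N / ℓ * ℓ <_) (sym (divmod N)) (m<m+n _ (n≢0⇒n>0 N%ℓ≢0))

module _ {N : ℕ} {S T : ℕ → Set} (tiling : Tiling N S T) (0<N : 0 < N) where
  open TilingProperties tiling 0<N

  tiling-runs : Decidable S → S 1 → ∃[ ℓ ] (2 ≤ ℓ × (∀ {t} → T t → ℓ ∣ t) × UnionOfRuns ℓ S × ℓ ∣ N)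
  tiling-runs S? S1 with least-counterexample S? (<-irrefl refl ∘ S<N)
  ... | 0 , ℓ∉S , _ = contradiction S0 ℓ∉S
  ... | 1 , ℓ∉S , _ = contradiction S1 ℓ∉S
  ... | ℓ@(suc (suc _)) , ℓ∉S , run = ℓ , s≤s (s≤s z≤n) , T-multiples , S-runs , ℓ∣N
    where open RunDecomposition tiling 0<N ℓ run ℓ∉S

SmallLabel : ∀ {a b} → Labelling a b → ℕ → ℕ → Set
SmallLabel f x n = ∃[ v ] (f v ≤ x × f v ≡ n)

LargeComplement : ∀ {a b} → Labelling a b → ℕ → ℕ → Set
LargeComplement {a} {b} f x n = ∃[ v ] (x < f v × a * b ∸ f v ≡ n)

difference : ∀ {a b} → Labelling a b → Fin a × Fin b → ℕ
difference f (i , j) = ∣ f (inj₁ i) - f (inj₂ j) ∣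

data Crossing {a b : ℕ} : Vertex a b → Vertex a b → Set where
  forward  : ∀ i j → Crossing (inj₁ i) (inj₂ j)
  backward : ∀ i j → Crossing (inj₂ j) (inj₁ i)

edge : ∀ {a b} {u w : Vertex a b} → Crossing u w → Fin a × Fin b
edge (forward i j)  = i , j
edge (backward i j) = i , j

crossing-difference : ∀ {a b} (f : Labelling a b) {u w} (c : Crossing u w) →
                      f u ≤ f w → difference f (edge c) ≡ f w ∸ f u
crossing-difference f (forward i j)  = m≤n⇒∣m-n∣≡n∸m
crossing-difference f (backward i j) = m≤n⇒∣n-m∣≡n∸m

crossing-unique : ∀ {a b} {f : Labelling a b} {x} {u w u′ w′}
                  (c : Crossing u w) (c′ : Crossing u′ w′) →
                  f u ≤ x → x < f w → f u′ ≤ x → x < f w′ → edge c ≡ edge c′ → u ≡ u′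
crossing-unique (forward i j)  (forward _ _)  _   _   _    _    refl = refl
crossing-unique (backward i j) (backward _ _) _   _   _    _    refl = refl
crossing-unique (forward i j)  (backward _ _) u≤x _   _    x<w′ refl = contradiction u≤x (<⇒≱ x<w′)
crossing-unique (backward i j) (forward _ _)  _   x<w u′≤x _    refl = contradiction u′≤x (<⇒≱ x<w)

complement-sum : ∀ {p q N} → p ≤ q → q ≤ N → p + (N ∸ q) + (q ∸ p) ≡ N
complement-sum {p} {q} {N} p≤q q≤N = begin
  p + (N ∸ q) + (q ∸ p)  ≡⟨ cong (_+ (q ∸ p)) (+-comm p (N ∸ q)) ⟩
  N ∸ q + p + (q ∸ p)    ≡⟨ +-assoc (N ∸ q) p (q ∸ p) ⟩
  N ∸ q + (p + (q ∸ p))  ≡⟨ cong (N ∸ q +_) (m+[n∸m]≡n p≤q) ⟩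
  N ∸ q + q              ≡⟨ m∸n+n≡m q≤N ⟩
  N                      ∎
  where open ≡-Reasoning

module _ {a b : ℕ} (f : Labelling a b) {x : ℕ} (sep : Separates f x) where
  private
    small-side₁ : Fin b → ∀ {i i′} → f (inj₁ i) ≤ x → f (inj₁ i′) ≤ x
    small-side₁ j {i} {i′} fi≤x with sep i j | sep i′ j
    ... | inj₂ (_ , x<fi)  | _                 = contradiction fi≤x (<⇒≱ x<fi)
    ... | inj₁ (_ , x<fj)  | inj₂ (fj≤x , _)   = contradiction fj≤x (<⇒≱ x<fj)
    ... | inj₁ _           | inj₁ (fi′≤x , _)  = fi′≤x

    small-side₂ : Fin a → ∀ {j j′} → f (inj₂ j) ≤ x → f (inj₂ j′) ≤ x
    small-side₂ i {j} {j′} fj≤x with sep i j | sep i j′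
    ... | inj₁ (_ , x<fj)  | _                 = contradiction fj≤x (<⇒≱ x<fj)
    ... | inj₂ (_ , x<fi)  | inj₁ (fi≤x , _)   = contradiction fi≤x (<⇒≱ x<fi)
    ... | inj₂ _           | inj₂ (fj′≤x , _)  = fj′≤x

  crossing : Fin a → Fin b → ∀ {u w} → f u ≤ x → x < f w → Crossing u w
  crossing _ _ {inj₁ i}  {inj₂ j}  _   _   = forward i j
  crossing _ _ {inj₂ j}  {inj₁ i}  _   _   = backward i j
  crossing _ j {inj₁ _}  {inj₁ _}  u≤x x<w = contradiction (small-side₁ j u≤x) (<⇒≱ x<w)
  crossing i _ {inj₂ _}  {inj₂ _}  u≤x x<w = contradiction (small-side₂ i u≤x) (<⇒≱ x<w)

  orient : ∀ i j → ∃[ u ] ∃[ w ] (f u ≤ x × x < f w × difference f (i , j) ≡ f w ∸ f u)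
  orient i j with sep i j
  ... | inj₁ (fi≤x , x<fj) =
    inj₁ i , inj₂ j , fi≤x , x<fj , crossing-difference f (forward i j) (<⇒≤ (≤-<-trans fi≤x x<fj))
  ... | inj₂ (fj≤x , x<fi) =
    inj₂ j , inj₁ i , fj≤x , x<fi , crossing-difference f (backward i j) (<⇒≤ (≤-<-trans fj≤x x<fi))

module _ {a b : ℕ} {f : Labelling a b} (av : IsAlphaValuation a b f) where
  open IsAlphaValuation av

  difference-injective : Injective _≡_ _≡_ (difference f)
  difference-injective {i , j} {i′ , j′} eq =
    ×-≡,≡→≡ (combine-injective i j i′ j′
      (onto[1,n]⇒injective D D-onto (trans (D∘combine i j) (trans eq (sym (D∘combine i′ j′))))))
    where
    D : Fin (a * b) → ℕ
    D = difference f ∘ remQuot b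
    D∘combine : ∀ i j → D (combine i j) ≡ difference f (i , j)
    D∘combine i j = cong (difference f) (remQuot-combine i j)
    D-onto : ∀ d → 1 ≤ d → d ≤ a * b → ∃[ k ] D k ≡ d
    D-onto d 1≤d d≤ab = let i , j , eq = diff-onto d 1≤d d≤ab in combine i j , trans (D∘combine i j) eq

  module _ {x : ℕ} (sep : Separates f x) (0<ab : 0 < a * b) where
    private
      sum<ab : ∀ {s t} → SmallLabel f x s → LargeComplement f x t → s + t < a * b
      sum<ab (u , u≤x , refl) (w , x<w , refl) =
        subst (f u + (a * b ∸ f w) <_) (complement-sum (<⇒≤ fu<fw) (bounded w))
              (m<m+n _ (m<n⇒0<n∸m fu<fw))
        where
        fu<fw : f u < f w
        fu<fw = ≤-<-trans u≤x x<w

      cover : ∀ {n} → n < a * b → ∃[ s ] ∃[ t ] (SmallLabel f x s × LargeComplement f x t × s + t ≡ n)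
      cover {n} n<ab =
        let i , j , difference≡ab∸n = diff-onto (a * b ∸ n) (m<n⇒0<n∸m n<ab) (m∸n≤m (a * b) n)
            u , w , u≤x , x<w , difference≡gap = orient f sep i j
            gap≡ab∸n = trans (sym difference≡gap) difference≡ab∸n
            sum+gap≡n+gap = begin
              f u + (a * b ∸ f w) + (a * b ∸ n)    ≡⟨ cong (f u + (a * b ∸ f w) +_) gap≡ab∸n ⟨
              f u + (a * b ∸ f w) + (f w ∸ f u)    ≡⟨ complement-sum (<⇒≤ (≤-<-trans u≤x x<w)) (bounded w) ⟩
              a * b                                ≡⟨ m+[n∸m]≡n (<⇒≤ n<ab) ⟨
              n + (a * b ∸ n)                      ∎
        in f u , a * b ∸ f w , (u , u≤x , refl) , (w , x<w , refl) , +-cancelʳ-≡ (a * b ∸ n) _ _ sum+gap≡n+gap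
        where open ≡-Reasoning

      unique : ∀ {s t s′ t′} → SmallLabel f x s → LargeComplement f x t →
               SmallLabel f x s′ → LargeComplement f x t′ → s + t ≡ s′ + t′ → s ≡ s′
      unique (u , u≤x , refl) (w , x<w , refl) (u′ , u′≤x , refl) (w′ , x<w′ , refl) eq =
        cong f (crossing-unique {f = f} c c′ u≤x x<w u′≤x x<w′ (difference-injective (begin
          difference f (edge c)  ≡⟨ crossing-difference f c (<⇒≤ (≤-<-trans u≤x x<w)) ⟩
          f w ∸ f u              ≡⟨ +-cancelˡ-≡ (f u + (a * b ∸ f w)) _ _ sums ⟩
          f w′ ∸ f u′            ≡⟨ crossing-difference f c′ (<⇒≤ (≤-<-trans u′≤x x<w′)) ⟨
          difference f (edge c′) ∎)))
        where
        open ≡-Reasoning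
        some-edge = diff-onto 1 ≤-refl 0<ab
        c = crossing f sep (proj₁ some-edge) (proj₁ (proj₂ some-edge)) u≤x x<w
        c′ = crossing f sep (proj₁ some-edge) (proj₁ (proj₂ some-edge)) u′≤x x<w′
        sums : f u + (a * b ∸ f w) + (f w ∸ f u) ≡ f u + (a * b ∸ f w) + (f w′ ∸ f u′)
        sums = trans (complement-sum (<⇒≤ (≤-<-trans u≤x x<w)) (bounded w))
                 (trans (sym (complement-sum (<⇒≤ (≤-<-trans u′≤x x<w′)) (bounded w′)))
                        (cong (_+ (f w′ ∸ f u′)) (sym eq)))

    valuation-tiling : Tiling (a * b) (SmallLabel f x) (LargeComplement f x)
    valuation-tiling = record { sum<N = sum<ab ; cover = cover ; unique = unique }

any-vertex? : ∀ {a b} {P : Vertex a b → Set} → Decidable P → Dec (∃ P)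
any-vertex? {P = P} P? = map′ join split (any? (P? ∘ inj₁) ⊎-dec any? (P? ∘ inj₂))
  where
  join : ∃ (P ∘ inj₁) ⊎ ∃ (P ∘ inj₂) → ∃ P
  join (inj₁ (i , p)) = inj₁ i , p
  join (inj₂ (j , p)) = inj₂ j , p
  split : ∃ P → ∃ (P ∘ inj₁) ⊎ ∃ (P ∘ inj₂)
  split (inj₁ i , p) = inj₁ (i , p)
  split (inj₂ j , p) = inj₂ (j , p)

small? : ∀ {a b} (f : Labelling a b) x → Decidable (SmallLabel f x)
small? f x n = any-vertex? (λ v → f v ≤? x ×-dec f v ≟ n)

∣N∸p-N∸q∣≡∣p-q∣ : ∀ {N p q} → p ≤ N → q ≤ N → ∣ N ∸ p - N ∸ q ∣ ≡ ∣ p - q ∣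
∣N∸p-N∸q∣≡∣p-q∣ {N} {p} {q} p≤N q≤N = begin
  ∣ N ∸ p - N ∸ q ∣                          ≡⟨ ∣m+n-m+o∣≡∣n-o∣ (p + q) (N ∸ p) (N ∸ q) ⟨
  ∣ p + q + (N ∸ p) - p + q + (N ∸ q) ∣      ≡⟨ cong₂ ∣_-_∣ p+q+[N∸p]≡N+q p+q+[N∸q]≡N+p ⟩
  ∣ N + q - N + p ∣                          ≡⟨ ∣m+n-m+o∣≡∣n-o∣ N q p ⟩
  ∣ q - p ∣                                  ≡⟨ ∣-∣-comm q p ⟩
  ∣ p - q ∣                                  ∎
  where
  open ≡-Reasoning
  p+q+[N∸p]≡N+q : p + q + (N ∸ p) ≡ N + q
  p+q+[N∸p]≡N+q = begin
    p + q + (N ∸ p)    ≡⟨ cong (_+ (N ∸ p)) (+-comm p q) ⟩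
    q + p + (N ∸ p)    ≡⟨ +-assoc q p (N ∸ p) ⟩
    q + (p + (N ∸ p))  ≡⟨ cong (q +_) (m+[n∸m]≡n p≤N) ⟩
    q + N              ≡⟨ +-comm q N ⟩
    N + q              ∎
  p+q+[N∸q]≡N+p : p + q + (N ∸ q) ≡ N + p
  p+q+[N∸q]≡N+p = begin
    p + q + (N ∸ q)    ≡⟨ +-assoc p q (N ∸ q) ⟩
    p + (q + (N ∸ q))  ≡⟨ cong (p +_) (m+[n∸m]≡n q≤N) ⟩
    p + N              ≡⟨ +-comm p N ⟩
    N + p              ∎

module _ {a b : ℕ} {f : Labelling a b} (av : IsAlphaValuation a b f) where
  open IsAlphaValuation av

  Φ-separates : ∀ {x} → Separates f x → Separates (Φ a b ∘ f) (a * b ∸ suc x)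
  Φ-separates sep i j with sep i j
  ... | inj₁ (fi≤x , x<fj) =
    inj₂ (∸-monoʳ-≤ (a * b) x<fj , ∸-monoʳ-< (s≤s fi≤x) (≤-trans x<fj (bounded (inj₂ j))))
  ... | inj₂ (fj≤x , x<fi) =
    inj₁ (∸-monoʳ-≤ (a * b) x<fi , ∸-monoʳ-< (s≤s fj≤x) (≤-trans x<fi (bounded (inj₁ i))))

  Φ-valuation : IsAlphaValuation a b (Φ a b ∘ f)
  Φ-valuation = record
    { injective  = λ {u} {v} eq → injective (∸-cancelˡ-≡ (bounded u) (bounded v) eq)
    ; bounded    = λ v → m∸n≤m (a * b) (f v)
    ; diff-range = λ i j → subst (λ d → 1 ≤ d × d ≤ a * b) (sym (Φ-difference i j)) (diff-range i j)
    ; diff-onto  = λ d 1≤d d≤ab →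
        let i , j , eq = diff-onto d 1≤d d≤ab in i , j , trans (Φ-difference i j) eq
    ; threshold  = let x , _ , sep = threshold in a * b ∸ suc x , m∸n≤m (a * b) (suc x) , Φ-separates sep
    }
    where
    Φ-difference : ∀ i j → difference (Φ a b ∘ f) (i , j) ≡ difference f (i , j)
    Φ-difference i j = ∣N∸p-N∸q∣≡∣p-q∣ (bounded (inj₁ i)) (bounded (inj₂ j))

normalise : ∀ {a b} {f : Labelling a b} → 1 < a * b → IsAlphaValuation a b f →
            ∃[ g ] (IsAlphaValuation a b g × Equivalent f g ×
                    ∃[ y ] (y ≤ a * b × Separates g y × SmallLabel g y 1))
normalise {a} {b} {f} 1<ab av with IsAlphaValuation.threshold av
... | x , x≤ab , sep with Tiling.cover (valuation-tiling av sep (<⇒≤ 1<ab)) 1<ab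
... | 1 , 0 , 1-small , _ , _ =
  f , av , inj₁ (λ _ → refl) , x , x≤ab , sep , 1-small
... | 0 , 1 , _ , (w , x<fw , ab∸fw≡1) , _ =
  Φ a b ∘ f , Φ-valuation av , inj₂ (λ _ → refl) ,
  a * b ∸ suc x , m∸n≤m (a * b) (suc x) , Φ-separates av sep , (w , ∸-monoʳ-≤ (a * b) x<fw , ab∸fw≡1)
... | 0 , 0 , _ , _ , ()
... | 0 , suc (suc _) , _ , _ , ()
... | 1 , suc _ , _ , _ , ()
... | suc (suc _) , _ , _ , _ , ()

valuation-runs : ∀ {a b} {g : Labelling a b} {y} → 1 < a * b → IsAlphaValuation a b g →
                 Separates g y → SmallLabel g y 1 →
                 ∃[ ℓ ] (2 ≤ ℓ × LargeMultiples g y ℓ × SmallRuns g y ℓ)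
valuation-runs {a} {b} {g} {y} 1<ab av sep 1-small =
  let ℓ , 2≤ℓ , T-multiples , S-runs , ℓ∣ab =
        tiling-runs (valuation-tiling av sep (<⇒≤ 1<ab)) (<⇒≤ 1<ab) (small? g y) 1-small
      large-multiple : LargeMultiples g y ℓ
      large-multiple v y<gv =
        let divides q gv≡qℓ = ∣m+n∣m⇒∣n (subst (ℓ ∣_) (sym (m∸n+n≡m (bounded v))) ℓ∣ab)
                                        (T-multiples (v , y<gv , refl))
        in q , gv≡qℓ
  in ℓ , 2≤ℓ , large-multiple , λ v gv≤y → S-runs (v , gv≤y , refl)
  where open IsAlphaValuation av

theorem2p1 : ∀ (a b : ℕ) (f : Labelling a b) → 1 < a * b → IsAlphaValuation a b f →
    ∃[ ℓ ] (2 ≤ ℓ × ∃[ g ] (IsAlphaValuation a b g × Equivalent f g ×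
      ∃[ x ] (x ≤ a * b × Separates g x × LargeMultiples g x ℓ × SmallRuns g x ℓ)))
theorem2p1 a b f 1<ab av =
  let g , g-valuation , f≈g , y , y≤ab , sep , 1-small = normalise 1<ab av
      ℓ , 2≤ℓ , large-multiples , small-runs = valuation-runs 1<ab g-valuation sep 1-small
  in ℓ , 2≤ℓ , g , g-valuation , f≈g , y , y≤ab , sep , large-multiples , small-runs
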